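{- Let $r \geq 1$ be an integer and let $G$ be an $r$-regular graph of order $n$. Then $\mathrm{LIF}(G) \geq \frac{2}{r+1}n$. Moreover, this bound is sharp: for every $r \geq 1$ there is an $r$-regular graph attaining equality.
   Context: All graphs are finite and simple. A linear forest is a forest every connected component of which is a path. $\mathrm{LIF}(G)$ denotes the maximum number of vertices of an induced subgraph of $G$ that is a linear forest. -}

module Defs where

open import Data.Nat using (ℕ; zero; suc; _+_; _*_; _≤_; _<_)
open import Data.Bool using (Bool; true; false)
open import Data.Fin using (Fin; zero; suc; inject₁; fromℕ)
open import Data.Fin.Subset using (Subset; _∈_; _∩_; ∣_∣)
open import Data.Vec using (tabulate)
open import Data.Product using (Σ; _×_)
open import Relation.Binary.PropositionalEquality using (_≡_)
open import Relation.Nullary using (¬_)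
open import Function.Definitions using (Injective)

record Graph (n : ℕ) : Set where
  field
    adj   : Fin n → Fin n → Bool
    sym   : ∀ u v → adj u v ≡ adj v u
    irrefl : ∀ u → adj u u ≡ false

open Graph public

N : ∀ {n} → Graph n → Fin n → Subset n
N G u = tabulate (adj G u)

deg : ∀ {n} → Graph n → Fin n → ℕ
deg G u = ∣ N G u ∣

Regular : ∀ {n} → ℕ → Graph n → Set
Regular r G = ∀ u → deg G u ≡ r

-- A cycle in the subgraph induced by S: distinct vertices
-- c 0, c 1, ..., c (m+2) (at least 3 of them), all in S, with consecutive
-- ones adjacent and the last adjacent to the first.
record CycleIn {n} (G : Graph n) (S : Subset n) : Set where
  field
    m       : ℕ
    c       : Fin (suc (suc (suc m))) → Fin n
    inj     : Injective _≡_ _≡_ c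
    inS     : ∀ i → c i ∈ S
    step    : ∀ (i : Fin (suc (suc m))) → adj G (c (inject₁ i)) (c (suc i)) ≡ true
    closing : adj G (c (fromℕ (suc (suc m)))) (c zero) ≡ true

-- The subgraph of G induced by S is a linear forest: it is a forest (has no
-- cycle) and each vertex has degree at most 2 in it (i.e. every component is
-- a path).
InducesLinearForest : ∀ {n} → Graph n → Subset n → Set
InducesLinearForest G S =
  (¬ CycleIn G S) × (∀ u → u ∈ S → ∣ S ∩ N G u ∣ ≤ 2)

-- By Lovász's partition theorem, the vertices of an r-regular graph can be coloured with classes
-- V_j, where r + 1 = Σ_j (d_j + 1) and d_j ∈ {1, 2}, so that G[V_j] has maximum degree at most d_j:
-- a colouring minimising Σ_j |E(G[V_j])| / d_j works, because moving a vertex with more than d_i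
-- neighbours in its class V_i to a class V_j where it has at most d_j neighbours decreases that sum.
-- A graph of maximum degree d ≤ 2 contains an induced forest, necessarily linear, on at least a
-- fraction 2 / (d + 1) of its vertices: keep everything if d = 1; otherwise keep vertices of degree at
-- most 1 one by one, and when there are none, trade a vertex for its two neighbours. Averaging over
-- the classes, one of these forests has at least 2n / (r + 1) vertices. The bound is attained by
-- K_{r+1}, in which every three vertices form a triangle.
module Submission where

open import Defs renaming (sym to adj-sym)
open import Algebra.Properties.CommutativeSemigroup using (x∙yz≈y∙xz)
open import Data.Bool using (Bool; true; false; _∧_; not; if_then_else_)
open import Data.Bool.Properties using (∧-zeroʳ)
open import Data.Fin using (Fin; zero; suc; inject₁; fromℕ)
open import Data.Fin.Properties using (any?; all?; ¬∀⟶∃¬)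
  renaming (_≟_ to _≟ᶠ_; suc-injective to suc-injectiveᶠ)
open import Data.Fin.Relation.Unary.Top using (view; ‵fromℕ; ‵inj₁)
open import Data.Fin.Subset
open import Data.Fin.Subset.Properties
open import Data.Nat using (ℕ; zero; suc; _+_; _*_; _≤_; _<_; z≤n; s≤s; s≤s⁻¹; _≤?_)
open import Data.Nat.Induction using (<-wellFounded)
open import Data.Nat.Properties
open import Algebra.Properties.Semiring.Sum +-*-semiring
  using (sum; sum-syntax; sum-cong-≗; sum-replicate-zero; ∑-distrib-+; ∑-comm;
         *-distribˡ-sum; *-distribʳ-sum)
open import Data.Product using (Σ; ∃; ∃₂; _×_; _,_; proj₁; proj₂)
open import Data.Sum using (_⊎_; inj₁; inj₂)
open import Data.Vec using (_∷_; there; tabulate)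
open import Data.Vec.Properties using (lookup∘tabulate; lookup⇒[]=; []=⇒lookup)
open import Data.Vec.Functional using (updateAt)
open import Data.Vec.Functional.Properties using (updateAt-updates; updateAt-minimal)
open import Function using (_∘_; id; const)
open import Function.Definitions using (Injective)
open import Induction.WellFounded using (Acc; acc)
open import Relation.Binary.PropositionalEquality
  using (_≡_; _≢_; refl; sym; trans; cong; cong₂; subst; subst₂; module ≡-Reasoning)
open import Relation.Nullary using (¬_; yes; no; does; contradiction)
open import Relation.Nullary.Decidable using (_×-dec_; dec-true; dec-false)

private variable n : ℕ

x∉p-x : ∀ (p : Subset n) x → x ∉ p - x
x∉p-x (_ ∷ p) zero    ()
x∉p-x (_ ∷ p) (suc x) (there x∈p-x) = x∉p-x p x x∈p-x

x∈p-y⇒x≢y : ∀ {p : Subset n} {x y} → x ∈ p - y → x ≢ y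
x∈p-y⇒x≢y {p = p} {x} x∈p-x refl = x∉p-x p x x∈p-x

∣p∣≤1+∣p-x∣ : ∀ (p : Subset n) x → ∣ p ∣ ≤ suc ∣ p - x ∣
∣p∣≤1+∣p-x∣ (inside  ∷ p) zero    = s≤s (≤-reflexive (cong ∣_∣ (sym (p─⊥≡p p))))
∣p∣≤1+∣p-x∣ (outside ∷ p) zero    = m≤n⇒m≤1+n (≤-reflexive (cong ∣_∣ (sym (p─⊥≡p p))))
∣p∣≤1+∣p-x∣ (inside  ∷ p) (suc x) = s≤s (∣p∣≤1+∣p-x∣ p x)
∣p∣≤1+∣p-x∣ (outside ∷ p) (suc x) = ∣p∣≤1+∣p-x∣ p x

x∉p⇒∣p∣<∣p∪⁅x⁆∣ : ∀ {p : Subset n} {x} → x ∉ p → ∣ p ∣ < ∣ p ∪ ⁅ x ⁆ ∣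
x∉p⇒∣p∣<∣p∪⁅x⁆∣ {x = x} x∉p = p⊂q⇒∣p∣<∣q∣ (p⊆p∪q ⁅ x ⁆ , x , x∈p∪q⁺ (inj₂ (x∈⁅x⁆ x)) , x∉p)

0<∣p∣⇒nonempty : ∀ (p : Subset n) → 0 < ∣ p ∣ → Nonempty p
0<∣p∣⇒nonempty {n} p 0<∣p∣ with nonempty? p
... | yes nonempty = nonempty
... | no  empty    = contradiction (trans (cong ∣_∣ (Empty-unique empty)) (∣⊥∣≡0 n)) (>⇒≢ 0<∣p∣)

1<∣p∣⇒distinct : ∀ (p : Subset n) → 1 < ∣ p ∣ → ∃₂ λ x y → x ∈ p × y ∈ p × x ≢ y
1<∣p∣⇒distinct p 1<∣p∣ with 0<∣p∣⇒nonempty p (<-trans (s≤s z≤n) 1<∣p∣)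
... | x , x∈p with 0<∣p∣⇒nonempty (p - x) (s≤s⁻¹ (≤-trans 1<∣p∣ (∣p∣≤1+∣p-x∣ p x)))
... | y , y∈p-x = x , y , x∈p , p─q⊆p p ⁅ x ⁆ y∈p-x , x∈p-y⇒x≢y y∈p-x ∘ sym

distinct⇒1<∣p∣ : ∀ {p : Subset n} {x y} → x ∈ p → y ∈ p → x ≢ y → 1 < ∣ p ∣
distinct⇒1<∣p∣ x∈p y∈p x≢y = <-≤-trans
  (s≤s (≤-<-trans z≤n (x∈p⇒∣p-x∣<∣p∣ (x∈p∧x≢y⇒x∈p-y y∈p (x≢y ∘ sym)))))
  (x∈p⇒∣p-x∣<∣p∣ x∈p)

injection⇒≤∣p∣ : ∀ {k} {p : Subset n} (f : Fin k → Fin n) →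
                 Injective _≡_ _≡_ f → (∀ i → f i ∈ p) → k ≤ ∣ p ∣
injection⇒≤∣p∣ {k = zero}  f _   _   = z≤n
injection⇒≤∣p∣ {k = suc k} f inj f∈p =
  ≤-trans (s≤s (injection⇒≤∣p∣ (f ∘ suc) (suc-injectiveᶠ ∘ inj) f[suc]∈p-f0))
          (x∈p⇒∣p-x∣<∣p∣ (f∈p zero))
  where
  f[suc]∈p-f0 : ∀ i → f (suc i) ∈ _ - f zero
  f[suc]∈p-f0 i = x∈p∧x≢y⇒x∈p-y (f∈p (suc i)) (λ eq → contradiction (inj eq) λ ())

∩-monoˡ-⊆ : ∀ {p q : Subset n} r → p ⊆ q → p ∩ r ⊆ q ∩ r
∩-monoˡ-⊆ {p = p} r p⊆q x∈p∩r with x∈p∩q⁻ p r x∈p∩r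
... | x∈p , x∈r = x∈p∩q⁺ (p⊆q x∈p , x∈r)

∉∪⁅y⁆ : ∀ {p : Subset n} {x y} → x ∉ p → x ≢ y → x ∉ p ∪ ⁅ y ⁆
∉∪⁅y⁆ {p = p} {y = y} x∉p x≢y x∈p∪y with x∈p∪q⁻ p ⁅ y ⁆ x∈p∪y
... | inj₁ x∈p   = x∉p x∈p
... | inj₂ x∈⁅y⁆ = x≢y (x∈⁅y⁆⇒x≡y y x∈⁅y⁆)

∪⁅x⁆-⊆ : ∀ {p q : Subset n} {x} → p ⊆ q → x ∈ q → p ∪ ⁅ x ⁆ ⊆ q
∪⁅x⁆-⊆ {p = p} {x = x} p⊆q x∈q y∈p∪x with x∈p∪q⁻ p ⁅ x ⁆ y∈p∪x
... | inj₁ y∈p   = p⊆q y∈p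
... | inj₂ y∈⁅x⁆ = subst (_∈ _) (sym (x∈⁅y⁆⇒x≡y x y∈⁅x⁆)) x∈q

∈-tabulate⁺ : ∀ (f : Fin n → Bool) {x} → f x ≡ true → x ∈ tabulate f
∈-tabulate⁺ f {x} fx = lookup⇒[]= x _ (trans (lookup∘tabulate f x) fx)

∈-tabulate⁻ : ∀ (f : Fin n → Bool) {x} → x ∈ tabulate f → f x ≡ true
∈-tabulate⁻ f {x} x∈f = trans (sym (lookup∘tabulate f x)) ([]=⇒lookup x∈f)

adj⇒≢ : ∀ (G : Graph n) {u v} → adj G u v ≡ true → u ≢ v
adj⇒≢ G {u} uv refl = contradiction (trans (sym uv) (irrefl G u)) λ ()

∈N-sym : ∀ (G : Graph n) {u v} → v ∈ N G u → u ∈ N G v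
∈N-sym G {u} {v} v∈Nu =
  ∈-tabulate⁺ (adj G v) (trans (adj-sym G v u) (∈-tabulate⁻ (adj G u) v∈Nu))

inject₁²≢suc² : ∀ (i : Fin n) → inject₁ (inject₁ i) ≢ suc (suc i)
inject₁²≢suc² zero    ()
inject₁²≢suc² (suc i) eq = inject₁²≢suc² i (suc-injectiveᶠ eq)

module _ {G : Graph n} {S : Subset n} (C : CycleIn G S) where
  open CycleIn C

  neighbours-on-cycle : ∀ i → ∃₂ λ a b →
    a ≢ b × adj G (c a) (c i) ≡ true × adj G (c i) (c b) ≡ true
  neighbours-on-cycle i with view i
  ... | ‵fromℕ              =
    inject₁ (fromℕ (suc m)) , zero , (λ ()) , step (fromℕ (suc m)) , closing
  ... | ‵inj₁ {i = zero}  _ =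
    fromℕ (suc (suc m)) , suc zero , (λ ()) , closing , step zero
  ... | ‵inj₁ {i = suc j} _ =
    inject₁ (inject₁ j) , suc (suc j) , inject₁²≢suc² j , step (inject₁ j) , step (suc j)

  branching-on-cycle : ∀ i → 1 < ∣ S ∩ N G (c i) ∣
  branching-on-cycle i with neighbours-on-cycle i
  ... | a , b , a≢b , ca~ci , ci~cb = distinct⇒1<∣p∣
    (x∈p∩q⁺ (inS a , ∈-tabulate⁺ (adj G (c i)) (trans (adj-sym G (c i) (c a)) ca~ci)))
    (x∈p∩q⁺ (inS b , ∈-tabulate⁺ (adj G (c i)) ci~cb))
    (a≢b ∘ inj)

  cycle⇒3≤∣S∣ : 3 ≤ ∣ S ∣
  cycle⇒3≤∣S∣ = ≤-trans (s≤s (s≤s (s≤s z≤n))) (injection⇒≤∣p∣ c inj inS)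

  cycle-within : ∀ {T} → (∀ i → c i ∈ T) → CycleIn G T
  cycle-within c∈T = record
    { m = m ; c = c ; inj = inj ; inS = c∈T ; step = step ; closing = closing }

∪⁅v⁆∩N⊆∩N : ∀ (G : Graph n) Y v → (Y ∪ ⁅ v ⁆) ∩ N G v ⊆ Y ∩ N G v
∪⁅v⁆∩N⊆∩N G Y v {u} u∈ with x∈p∩q⁻ (Y ∪ ⁅ v ⁆) (N G v) u∈
... | u∈Y∪v , u∈Nv with x∈p∪q⁻ Y ⁅ v ⁆ u∈Y∪v
...   | inj₁ u∈Y   = x∈p∩q⁺ (u∈Y , u∈Nv)
...   | inj₂ u∈⁅v⁆ =
  contradiction (x∈⁅y⁆⇒x≡y v u∈⁅v⁆) (adj⇒≢ G (∈-tabulate⁻ (adj G v) u∈Nv) ∘ sym)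

acyclic-∪-leaf : ∀ (G : Graph n) {Y} v → ¬ CycleIn G Y → ∣ Y ∩ N G v ∣ ≤ 1 →
                 ¬ CycleIn G (Y ∪ ⁅ v ⁆)
acyclic-∪-leaf G {Y} v acyclic v-leaf C with any? (λ i → CycleIn.c C i ≟ᶠ v)
... | yes (i , ci≡v) = <⇒≱
  (subst (λ u → 1 < ∣ (Y ∪ ⁅ v ⁆) ∩ N G u ∣) ci≡v (branching-on-cycle C i))
  (≤-trans (p⊆q⇒∣p∣≤∣q∣ (∪⁅v⁆∩N⊆∩N G Y v)) v-leaf)
... | no  v∉C = acyclic (cycle-within C c∈Y)
  where
  open CycleIn C
  c∈Y : ∀ i → c i ∈ Y
  c∈Y i with x∈p∪q⁻ Y ⁅ v ⁆ (inS i)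
  ... | inj₁ ci∈Y   = ci∈Y
  ... | inj₂ ci∈⁅v⁆ = contradiction (i , x∈⁅y⁆⇒x≡y v ci∈⁅v⁆) v∉C

-- Induced forests in graphs of maximum degree at most 2

InducedMaxDegree≤ : Graph n → Subset n → ℕ → Set
InducedMaxDegree≤ G Q d = ∀ u → u ∈ Q → ∣ Q ∩ N G u ∣ ≤ d

InducedMaxDegree≤-⊆ : ∀ (G : Graph n) {P Q d} → P ⊆ Q →
                      InducedMaxDegree≤ G Q d → InducedMaxDegree≤ G P d
InducedMaxDegree≤-⊆ G P⊆Q Δ≤d u u∈P =
  ≤-trans (p⊆q⇒∣p∣≤∣q∣ (∩-monoˡ-⊆ (N G u) P⊆Q)) (Δ≤d u (P⊆Q u∈P))

max-degree≤1⇒acyclic : ∀ (G : Graph n) {Q} → InducedMaxDegree≤ G Q 1 → ¬ CycleIn G Q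
max-degree≤1⇒acyclic G Δ≤1 C = <⇒≱ (branching-on-cycle C zero) (Δ≤1 _ (CycleIn.inS C zero))

record LargeForestIn (G : Graph n) (d : ℕ) (Q : Subset n) : Set where
  field
    forest   : Subset n
    forest⊆Q : forest ⊆ Q
    acyclic  : ¬ CycleIn G forest
    large    : 2 * ∣ Q ∣ ≤ suc d * ∣ forest ∣

ratio-step : ∀ d {q q′ y y′} k k′ → 2 * k ≤ suc d * k′ → q ≤ k + q′ → k′ + y′ ≤ y →
             2 * q′ ≤ suc d * y′ → 2 * q ≤ suc d * y
ratio-step d {q} {q′} {y} {y′} k k′ 2k≤ q≤ ≤y 2q′≤ = begin
  2 * q                   ≤⟨ *-monoʳ-≤ 2 q≤ ⟩
  2 * (k + q′)            ≡⟨ *-distribˡ-+ 2 k q′ ⟩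
  2 * k + 2 * q′          ≤⟨ +-mono-≤ 2k≤ 2q′≤ ⟩
  suc d * k′ + suc d * y′ ≡⟨ *-distribˡ-+ (suc d) k′ y′ ⟨
  suc d * (k′ + y′)       ≤⟨ *-monoʳ-≤ (suc d) ≤y ⟩
  suc d * y               ∎
  where open ≤-Reasoning

module _ {G : Graph n} {Q : Subset n} where
  open LargeForestIn

  large-forest-∪-leaf : ∀ {d v} → 1 ≤ d → v ∈ Q → ∣ Q ∩ N G v ∣ ≤ 1 →
                        LargeForestIn G d (Q - v) → LargeForestIn G d Q
  large-forest-∪-leaf {d} {v} 1≤d v∈Q v-leaf F = record
    { forest   = forest F ∪ ⁅ v ⁆
    ; forest⊆Q = ∪⁅x⁆-⊆ F⊆Q v∈Q
    ; acyclic  = acyclic-∪-leaf G v (acyclic F)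
                   (≤-trans (p⊆q⇒∣p∣≤∣q∣ (∩-monoˡ-⊆ (N G v) F⊆Q)) v-leaf)
    ; large    = ratio-step d 1 1 (s≤s (≤-trans 1≤d (≤-reflexive (sym (*-identityʳ d)))))
                   (∣p∣≤1+∣p-x∣ Q v) (x∉p⇒∣p∣<∣p∪⁅x⁆∣ (x∉p-x Q v ∘ forest⊆Q F)) (large F)
    }
    where
    F⊆Q : forest F ⊆ Q
    F⊆Q = ⊆-trans (forest⊆Q F) (p─q⊆p Q ⁅ v ⁆)

  -- Each of u, w has v among its at most two neighbours in Q, so it has at most one neighbour in
  -- the forest: three vertices are removed from Q and two are added to the forest.
  large-forest-∪-cherry : ∀ {v u w} → InducedMaxDegree≤ G Q 2 →
                          v ∈ Q → u ∈ Q ∩ N G v → w ∈ Q ∩ N G v → u ≢ w →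
                          LargeForestIn G 2 (Q - v - u - w) → LargeForestIn G 2 Q
  large-forest-∪-cherry {v} {u} {w} Δ≤2 v∈Q u∈Q∩Nv w∈Q∩Nv u≢w F = record
    { forest   = F∪u ∪ ⁅ w ⁆
    ; forest⊆Q = ∪⁅x⁆-⊆ F∪u⊆Q w∈Q
    ; acyclic  = acyclic-∪-leaf G w
                   (acyclic-∪-leaf G u (acyclic F) (leaf-without-v F⊆Q v∉F u∈Q∩Nv))
                   (leaf-without-v F∪u⊆Q (∉∪⁅y⁆ v∉F v≢u) w∈Q∩Nv)
    ; large    = ratio-step 2 3 2 ≤-refl ∣Q∣≤3+∣Q-v-u-w∣
                   (≤-trans (s≤s (x∉p⇒∣p∣<∣p∪⁅x⁆∣ u∉F))
                            (x∉p⇒∣p∣<∣p∪⁅x⁆∣ (∉∪⁅y⁆ w∉F (u≢w ∘ sym))))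
                   (large F)
    }
    where
    u∈Q = proj₁ (x∈p∩q⁻ Q (N G v) u∈Q∩Nv)
    w∈Q = proj₁ (x∈p∩q⁻ Q (N G v) w∈Q∩Nv)
    v≢u = adj⇒≢ G (∈-tabulate⁻ (adj G v) (proj₂ (x∈p∩q⁻ Q (N G v) u∈Q∩Nv)))
    F∪u = forest F ∪ ⁅ u ⁆
    F⊆Q-v-u : forest F ⊆ Q - v - u
    F⊆Q-v-u = ⊆-trans (forest⊆Q F) (p─q⊆p (Q - v - u) ⁅ w ⁆)
    F⊆Q-v : forest F ⊆ Q - v
    F⊆Q-v = ⊆-trans F⊆Q-v-u (p─q⊆p (Q - v) ⁅ u ⁆)
    F⊆Q : forest F ⊆ Q
    F⊆Q = ⊆-trans F⊆Q-v (p─q⊆p Q ⁅ v ⁆)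
    F∪u⊆Q : F∪u ⊆ Q
    F∪u⊆Q = ∪⁅x⁆-⊆ F⊆Q u∈Q
    v∉F : v ∉ forest F
    v∉F = x∉p-x Q v ∘ F⊆Q-v
    u∉F : u ∉ forest F
    u∉F = x∉p-x (Q - v) u ∘ F⊆Q-v-u
    w∉F : w ∉ forest F
    w∉F = x∉p-x (Q - v - u) w ∘ forest⊆Q F
    ∣Q∣≤3+∣Q-v-u-w∣ : ∣ Q ∣ ≤ 3 + ∣ Q - v - u - w ∣
    ∣Q∣≤3+∣Q-v-u-w∣ = ≤-trans (∣p∣≤1+∣p-x∣ Q v)
      (s≤s (≤-trans (∣p∣≤1+∣p-x∣ (Q - v) u) (s≤s (∣p∣≤1+∣p-x∣ (Q - v - u) w))))
    leaf-without-v : ∀ {Z x} → Z ⊆ Q → v ∉ Z → x ∈ Q ∩ N G v → ∣ Z ∩ N G x ∣ ≤ 1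
    leaf-without-v {Z} {x} Z⊆Q v∉Z x∈Q∩Nv with x∈p∩q⁻ Q (N G v) x∈Q∩Nv
    ... | x∈Q , x∈Nv = s≤s⁻¹ (≤-trans (p⊂q⇒∣p∣<∣q∣ Z∩Nx⊂Q∩Nx) (Δ≤2 x x∈Q))
      where
      Z∩Nx⊂Q∩Nx : Z ∩ N G x ⊂ Q ∩ N G x
      Z∩Nx⊂Q∩Nx = ∩-monoˡ-⊆ (N G x) Z⊆Q , v , x∈p∩q⁺ (v∈Q , ∈N-sym G x∈Nv) ,
                  v∉Z ∘ proj₁ ∘ x∈p∩q⁻ Z (N G x)

large-forest-max-degree-2 : ∀ (G : Graph n) Q → InducedMaxDegree≤ G Q 2 → LargeForestIn G 2 Q
large-forest-max-degree-2 G Q Δ≤2 = go Q Δ≤2 (<-wellFounded ∣ Q ∣)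
  where
  go : ∀ Q → InducedMaxDegree≤ G Q 2 → Acc _<_ ∣ Q ∣ → LargeForestIn G 2 Q
  go Q Δ≤2 (acc smaller) with any? (λ v → v ∈? Q ×-dec ∣ Q ∩ N G v ∣ ≤? 1)
  ... | yes (v , v∈Q , v-leaf) = large-forest-∪-leaf (s≤s z≤n) v∈Q v-leaf
    (go (Q - v) (InducedMaxDegree≤-⊆ G (p─q⊆p Q ⁅ v ⁆) Δ≤2) (smaller (x∈p⇒∣p-x∣<∣p∣ v∈Q)))
  ... | no no-leaf with nonempty? Q
  ...   | no empty = record
    { forest = Q ; forest⊆Q = id ; acyclic = λ C → empty (_ , CycleIn.inS C zero)
    ; large = *-monoˡ-≤ ∣ Q ∣ (n≤1+n 2) }
  ...   | yes (v , v∈Q)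
    with 1<∣p∣⇒distinct (Q ∩ N G v) (≰⇒> (λ v-leaf → no-leaf (v , v∈Q , v-leaf)))
  ...     | u , w , u∈Q∩Nv , w∈Q∩Nv , u≢w = large-forest-∪-cherry Δ≤2 v∈Q u∈Q∩Nv w∈Q∩Nv u≢w
    (go (Q - v - u - w) (InducedMaxDegree≤-⊆ G Q-v-u-w⊆Q Δ≤2)
        (smaller (≤-<-trans (p⊆q⇒∣p∣≤∣q∣ Q-v-u-w⊆Q-v) (x∈p⇒∣p-x∣<∣p∣ v∈Q))))
    where
    Q-v-u-w⊆Q-v : Q - v - u - w ⊆ Q - v
    Q-v-u-w⊆Q-v = ⊆-trans (p─q⊆p (Q - v - u) ⁅ w ⁆) (p─q⊆p (Q - v) ⁅ u ⁆)
    Q-v-u-w⊆Q : Q - v - u - w ⊆ Q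
    Q-v-u-w⊆Q = ⊆-trans Q-v-u-w⊆Q-v (p─q⊆p Q ⁅ v ⁆)

large-forest : ∀ (G : Graph n) {Q} d → 1 ≤ d → d ≤ 2 → InducedMaxDegree≤ G Q d →
               LargeForestIn G d Q
large-forest G {Q} 1 _ _ Δ≤1 = record
  { forest = Q ; forest⊆Q = id ; acyclic = max-degree≤1⇒acyclic G Δ≤1 ; large = ≤-refl }
large-forest G {Q} 2 _ _ Δ≤2 = large-forest-max-degree-2 G Q Δ≤2
large-forest G (suc (suc (suc _))) _ (s≤s (s≤s ())) _

𝟙 : Bool → ℕ
𝟙 true  = 1
𝟙 false = 0

∣tabulate∣≡∑𝟙 : ∀ (f : Fin n → Bool) → ∣ tabulate f ∣ ≡ ∑[ i < n ] 𝟙 (f i)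
∣tabulate∣≡∑𝟙 {zero}  f = refl
∣tabulate∣≡∑𝟙 {suc n} f with f zero
... | true  = cong suc (∣tabulate∣≡∑𝟙 (f ∘ suc))
... | false = ∣tabulate∣≡∑𝟙 (f ∘ suc)

tabulate-∩ : ∀ (f g : Fin n → Bool) → tabulate f ∩ tabulate g ≡ tabulate (λ i → f i ∧ g i)
tabulate-∩ {zero}  f g = refl
tabulate-∩ {suc n} f g = cong (f zero ∧ g zero ∷_) (tabulate-∩ (f ∘ suc) (g ∘ suc))

∑-mono-≤ : ∀ {f g : Fin n → ℕ} → (∀ i → f i ≤ g i) → sum f ≤ sum g
∑-mono-≤ {zero}  f≤g = z≤n
∑-mono-≤ {suc n} f≤g = +-mono-≤ (f≤g zero) (∑-mono-≤ (f≤g ∘ suc))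

∑-mono-< : ∀ {f g : Fin (suc n) → ℕ} → (∀ i → f i < g i) → sum f < sum g
∑-mono-< f<g = +-mono-<-≤ (f<g zero) (∑-mono-≤ (<⇒≤ ∘ f<g ∘ suc))

∑<∑⇒∃< : ∀ {f g : Fin n → ℕ} → sum f < sum g → ∃ λ i → f i < g i
∑<∑⇒∃< {f = f} {g} ∑f<∑g with any? (λ i → f i <? g i)
... | yes f<g = f<g
... | no  f≮g = contradiction (∑-mono-≤ (λ i → ≮⇒≥ (f≮g ∘ (i ,_)))) (<⇒≱ ∑f<∑g)

∑≤∑⇒∃≤ : ∀ {f g : Fin (suc n) → ℕ} → sum f ≤ sum g → ∃ λ i → f i ≤ g i
∑≤∑⇒∃≤ {f = f} {g} ∑f≤∑g with any? (λ i → f i ≤? g i)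
... | yes f≤g = f≤g
... | no  f≰g = contradiction (∑-mono-< (λ i → ≰⇒> (f≰g ∘ (i ,_)))) (≤⇒≯ ∑f≤∑g)

∑-δ : ∀ (x : Fin n) a → ∑[ i < n ] (if does (i ≟ᶠ x) then a else 0) ≡ a
∑-δ {suc n} zero    a = trans (cong (a +_) (sum-replicate-zero n)) (+-identityʳ a)
∑-δ {suc n} (suc x) a = ∑-δ x a

∑-perturb : ∀ {f g : Fin n → ℕ} x a b →
            (∀ i → f i + (if does (i ≟ᶠ x) then a else 0) ≡
                   g i + (if does (i ≟ᶠ x) then b else 0)) →
            sum f + a ≡ sum g + b
∑-perturb {f = f} {g} x a b pointwise = begin
  sum f + a                ≡⟨ cong (sum f +_) (∑-δ x a) ⟨
  sum f + sum (δ a)        ≡⟨ ∑-distrib-+ f (δ a) ⟨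
  sum (λ i → f i + δ a i)  ≡⟨ sum-cong-≗ pointwise ⟩
  sum (λ i → g i + δ b i)  ≡⟨ ∑-distrib-+ g (δ b) ⟩
  sum g + sum (δ b)        ≡⟨ cong (sum g +_) (∑-δ x b) ⟩
  sum g + b                ∎
  where
  open ≡-Reasoning
  δ : ℕ → Fin _ → ℕ
  δ c i = if does (i ≟ᶠ x) then c else 0

∑-𝟙[≟] : ∀ (c : Fin n) → ∑[ j < n ] 𝟙 (does (c ≟ᶠ j)) ≡ 1
∑-𝟙[≟] {suc n} zero    = cong suc (sum-replicate-zero n)
∑-𝟙[≟] {suc n} (suc c) = ∑-𝟙[≟] c

∑-𝟙[≟∧] : ∀ (c : Fin n) b → ∑[ j < n ] 𝟙 (does (c ≟ᶠ j) ∧ b) ≡ 𝟙 b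
∑-𝟙[≟∧] {suc n} zero    b = trans (cong (𝟙 b +_) (sum-replicate-zero n)) (+-identityʳ (𝟙 b))
∑-𝟙[≟∧] {suc n} (suc c) b = ∑-𝟙[≟∧] c b

∑-1≡n : ∀ n → ∑[ i < n ] 1 ≡ n
∑-1≡n zero    = refl
∑-1≡n (suc n) = cong suc (∑-1≡n n)

weighted-pigeonhole : ∀ {p} k (q y c : Fin (suc p) → ℕ) → (∀ j → k * q j ≤ suc (c j) * y j) →
                      ∃ λ j → k * sum q ≤ sum (suc ∘ c) * y j
weighted-pigeonhole k q y c ratio =
  let j , le = ∑≤∑⇒∃≤ {f = λ j → suc (c j) * (k * sum q)} {g = λ j → suc (c j) * (C * y j)} total
  in j , *-cancelˡ-≤ (suc (c j)) le
  where
  open ≤-Reasoning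
  C = sum (suc ∘ c)
  total : sum (λ j → suc (c j) * (k * sum q)) ≤ sum (λ j → suc (c j) * (C * y j))
  total = begin
    sum (λ j → suc (c j) * (k * sum q))  ≡⟨ *-distribʳ-sum (k * sum q) (suc ∘ c) ⟨
    C * (k * sum q)                      ≡⟨ cong (C *_) (*-distribˡ-sum k q) ⟩
    C * sum (λ j → k * q j)              ≤⟨ *-monoʳ-≤ C (∑-mono-≤ ratio) ⟩
    C * sum (λ j → suc (c j) * y j)      ≡⟨ *-distribˡ-sum C (λ j → suc (c j) * y j) ⟩
    sum (λ j → C * (suc (c j) * y j))
      ≡⟨ sum-cong-≗ (λ j → x∙yz≈y∙xz *-commutativeSemigroup C (suc (c j)) (y j)) ⟩
    sum (λ j → suc (c j) * (C * y j))    ∎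

-- Lovász's partition theorem

colour-class : ∀ {P} → (Fin n → Fin P) → Fin P → Subset n
colour-class col j = tabulate (λ v → does (col v ≟ᶠ j))

∈colour-class⇒≡ : ∀ {P} (col : Fin n → Fin P) {j u} → u ∈ colour-class col j → col u ≡ j
∈colour-class⇒≡ col {j} {u} u∈ with col u ≟ᶠ j | ∈-tabulate⁻ (λ v → does (col v ≟ᶠ j)) u∈
... | yes cu≡j | _ = cu≡j
... | no  _    | ()

∑∣colour-class∣≡n : ∀ {P} (col : Fin n → Fin P) → ∑[ j < P ] ∣ colour-class col j ∣ ≡ n
∑∣colour-class∣≡n {n} {P} col = begin
  ∑[ j < P ] ∣ colour-class col j ∣
    ≡⟨ sum-cong-≗ (λ j → ∣tabulate∣≡∑𝟙 (λ v → does (col v ≟ᶠ j))) ⟩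
  ∑[ j < P ] ∑[ v < n ] 𝟙 (does (col v ≟ᶠ j))  ≡⟨ ∑-comm (λ j v → 𝟙 (does (col v ≟ᶠ j))) ⟩
  ∑[ v < n ] ∑[ j < P ] 𝟙 (does (col v ≟ᶠ j))  ≡⟨ sum-cong-≗ (∑-𝟙[≟] ∘ col) ⟩
  ∑[ v < n ] 1                                 ≡⟨ ∑-1≡n n ⟩
  n                                            ∎
  where open ≡-Reasoning

-- With d j * w j ≡ W, Φ col = 2 W Σ_j |E(G[colour-class col j])| / d j.
module LovászPartition {n P : ℕ} (G : Graph n) (d w : Fin P → ℕ) (W : ℕ)
  (d*w≡W : ∀ j → d j * w j ≡ W) (w>0 : ∀ j → 0 < w j)
  (deg<∑[1+d] : ∀ x → deg G x < ∑[ j < P ] suc (d j)) where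

  Colouring : Set
  Colouring = Fin n → Fin P

  neighbourIn : Colouring → Fin n → Fin P → Fin n → Bool
  neighbourIn col x j v = does (col v ≟ᶠ j) ∧ adj G x v

  degIn : Colouring → Fin n → Fin P → ℕ
  degIn col x j = ∑[ v < n ] 𝟙 (neighbourIn col x j v)

  Bounded : Colouring → Set
  Bounded col = ∀ x → degIn col x (col x) ≤ d (col x)

  weight : Colouring → Fin n → Fin n → ℕ
  weight col u v = 𝟙 (neighbourIn col u (col u) v) * w (col u)

  row : Colouring → Fin n → ℕ
  row col u = ∑[ v < n ] weight col u v

  Φ : Colouring → ℕ
  Φ col = ∑[ u < n ] row col u

  recolour : Colouring → Fin n → Fin P → Colouring
  recolour col x j = updateAt col x (const j)

  weight-sym : ∀ col u v → weight col u v ≡ weight col v u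
  weight-sym col u v with col v ≟ᶠ col u | col u ≟ᶠ col v
  ... | yes cv≡cu | yes _     = cong₂ (λ a c → 𝟙 a * w c) (adj-sym G u v) (sym cv≡cu)
  ... | yes cv≡cu | no  cu≢cv = contradiction (sym cv≡cu) cu≢cv
  ... | no  cv≢cu | yes cu≡cv = contradiction (sym cu≡cv) cv≢cu
  ... | no  _     | no  _     = refl

  loop-weight≡0 : ∀ b u c → 𝟙 (b ∧ adj G u u) * c ≡ 0
  loop-weight≡0 b u c rewrite irrefl G u | ∧-zeroʳ b = refl

  weight-diag : ∀ col u → weight col u u ≡ 0
  weight-diag col u = loop-weight≡0 (does (col u ≟ᶠ col u)) u (w (col u))

  row≡degIn*w : ∀ col x → row col x ≡ degIn col x (col x) * w (col x)
  row≡degIn*w col x = sym (*-distribʳ-sum (w (col x)) (𝟙 ∘ neighbourIn col x (col x)))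

  ∑degIn≡deg : ∀ col x → ∑[ j < P ] degIn col x j ≡ deg G x
  ∑degIn≡deg col x = begin
    ∑[ j < P ] ∑[ v < n ] 𝟙 (neighbourIn col x j v)
      ≡⟨ ∑-comm (λ j v → 𝟙 (neighbourIn col x j v)) ⟩
    ∑[ v < n ] ∑[ j < P ] 𝟙 (neighbourIn col x j v)
      ≡⟨ sum-cong-≗ (λ v → ∑-𝟙[≟∧] (col v) (adj G x v)) ⟩
    ∑[ v < n ] 𝟙 (adj G x v)
      ≡⟨ ∣tabulate∣≡∑𝟙 (adj G x) ⟨
    deg G x ∎
    where open ≡-Reasoning

  bounded⇒class-max-degree : ∀ col → Bounded col →
                             ∀ j → InducedMaxDegree≤ G (colour-class col j) (d j)
  bounded⇒class-max-degree col bounded j u u∈class =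
    subst (λ i → ∣ colour-class col i ∩ N G u ∣ ≤ d i) (∈colour-class⇒≡ col u∈class)
      (≤-trans (≤-reflexive ∣class∩N∣≡degIn) (bounded u))
    where
    ∣class∩N∣≡degIn : ∣ colour-class col (col u) ∩ N G u ∣ ≡ degIn col u (col u)
    ∣class∩N∣≡degIn = trans (cong ∣_∣ (tabulate-∩ (λ v → does (col v ≟ᶠ col u)) (adj G u)))
                            (∣tabulate∣≡∑𝟙 (neighbourIn col u (col u)))

  module _ (col : Colouring) (x : Fin n) (j : Fin P) where
    private
      col′ = recolour col x j

    row-recolour : row col′ x ≡ degIn col x j * w j
    row-recolour = trans (sum-cong-≗ pointwise) (sym (*-distribʳ-sum (w j) (𝟙 ∘ neighbourIn col x j)))
      where
      pointwise : ∀ v → weight col′ x v ≡ 𝟙 (neighbourIn col x j v) * w j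
      pointwise v with v ≟ᶠ x
      ... | yes refl = trans (weight-diag col′ v) (sym (loop-weight≡0 (does (col v ≟ᶠ j)) v (w j)))
      ... | no  v≢x  = cong₂ (λ a b → 𝟙 (does (a ≟ᶠ b) ∧ adj G x v) * w b)
                             (updateAt-minimal v x col v≢x) (updateAt-updates x col)

    -- Recolouring x changes only row x and column x of the symmetric matrix weight.
    row-identity : ∀ u →
      row col′ u + weight col u x + (if does (u ≟ᶠ x) then row col x else 0) ≡
      row col u + weight col′ u x + (if does (u ≟ᶠ x) then row col′ x else 0)
    row-identity u with u ≟ᶠ x
    ... | yes refl rewrite weight-diag col u | weight-diag col′ u
                         | +-identityʳ (row col′ u) | +-identityʳ (row col u) =
      +-comm (row col′ u) (row col u)
    ... | no  u≢x  = cong (_+ 0) (∑-perturb x (weight col u x) (weight col′ u x) pointwise)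
      where
      pointwise : ∀ v → weight col′ u v + (if does (v ≟ᶠ x) then weight col u x else 0) ≡
                        weight col u v + (if does (v ≟ᶠ x) then weight col′ u x else 0)
      pointwise v with v ≟ᶠ x
      ... | yes refl = +-comm (weight col′ u x) (weight col u x)
      ... | no  v≢x  = cong (_+ 0) (cong₂ (λ a b → 𝟙 (does (a ≟ᶠ b) ∧ adj G u v) * w b)
                                          (updateAt-minimal v x col v≢x)
                                          (updateAt-minimal u x col u≢x))

    Φ-recolour : Φ col′ + row col x + row col x ≡ Φ col + row col′ x + row col′ x
    Φ-recolour = begin
      Φ col′ + row col x + row col x
        ≡⟨ cong (λ a → Φ col′ + a + row col x) (column≡row col) ⟨
      Φ col′ + ∑[ u < n ] weight col u x + row col x
        ≡⟨ cong (_+ row col x) (∑-distrib-+ (row col′) (λ u → weight col u x)) ⟨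
      ∑[ u < n ] (row col′ u + weight col u x) + row col x
        ≡⟨ ∑-perturb x (row col x) (row col′ x) row-identity ⟩
      ∑[ u < n ] (row col u + weight col′ u x) + row col′ x
        ≡⟨ cong (_+ row col′ x) (∑-distrib-+ (row col) (λ u → weight col′ u x)) ⟩
      Φ col + ∑[ u < n ] weight col′ u x + row col′ x
        ≡⟨ cong (λ a → Φ col + a + row col′ x) (column≡row col′) ⟩
      Φ col + row col′ x + row col′ x ∎
      where
      open ≡-Reasoning
      column≡row : ∀ c → ∑[ u < n ] weight c u x ≡ row c x
      column≡row c = sum-cong-≗ (λ u → weight-sym c u x)

    recolouring-decreases-Φ : degIn col x j ≤ d j → d (col x) < degIn col x (col x) →
                              Φ col′ < Φ col
    recolouring-decreases-Φ fits overfull = +-cancelʳ-< (R + R) (Φ col′) (Φ col) (begin-strict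
      Φ col′ + (R + R)  ≡⟨ +-assoc (Φ col′) R R ⟨
      Φ col′ + R + R    ≡⟨ Φ-recolour ⟩
      Φ col + R′ + R′   ≡⟨ +-assoc (Φ col) R′ R′ ⟩
      Φ col + (R′ + R′) <⟨ +-monoʳ-< (Φ col) (+-mono-< R′<R R′<R) ⟩
      Φ col + (R + R)   ∎)
      where
      open ≤-Reasoning
      i = col x
      R = row col x
      R′ = row col′ x
      R′<R : R′ < R
      R′<R = begin-strict
        R′                   ≡⟨ row-recolour ⟩
        degIn col x j * w j  ≤⟨ *-monoˡ-≤ (w j) fits ⟩
        d j * w j            ≡⟨ d*w≡W j ⟩
        W                    ≡⟨ d*w≡W i ⟨
        d i * w i            <⟨ m<n+m (d i * w i) (w>0 i) ⟩
        suc (d i) * w i      ≤⟨ *-monoˡ-≤ (w i) overfull ⟩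
        degIn col x i * w i  ≡⟨ row≡degIn*w col x ⟨
        R                    ∎

  bounded-or-improvable : ∀ col → Bounded col ⊎ ∃ λ col′ → Φ col′ < Φ col
  bounded-or-improvable col with all? (λ x → degIn col x (col x) ≤? d (col x))
  ... | yes bounded = inj₁ bounded
  ... | no  unbounded with ¬∀⟶∃¬ n _ (λ x → degIn col x (col x) ≤? d (col x)) unbounded
  ...   | x , overfull
    with ∑<∑⇒∃< (subst (_< ∑[ j < P ] suc (d j)) (sym (∑degIn≡deg col x)) (deg<∑[1+d] x))
  ...     | j , fits =
    inj₂ (recolour col x j , recolouring-decreases-Φ col x j (s≤s⁻¹ fits) (≰⇒> overfull))

  bounded-colouring : Colouring → ∃ Bounded
  bounded-colouring col₀ = descend col₀ (<-wellFounded (Φ col₀))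
    where
    descend : ∀ col → Acc _<_ (Φ col) → ∃ Bounded
    descend col (acc smaller) with bounded-or-improvable col
    ... | inj₁ bounded       = col , bounded
    ... | inj₂ (col′ , Φ′<Φ) = descend col′ (smaller Φ′<Φ)

module _ {p} (G : Graph n) (col : Fin n → Fin (suc p)) (d : Fin (suc p) → ℕ)
         (1≤d : ∀ j → 1 ≤ d j) (d≤2 : ∀ j → d j ≤ 2)
         (Δ≤d : ∀ j → InducedMaxDegree≤ G (colour-class col j) (d j)) where
  open LargeForestIn

  private
    F : ∀ j → LargeForestIn G (d j) (colour-class col j)
    F j = large-forest G (d j) (1≤d j) (d≤2 j) (Δ≤d j)

  large-linear-forest-of-partition :
    Σ (Subset n) λ S → InducesLinearForest G S × 2 * n ≤ ∑[ j < suc p ] suc (d j) * ∣ S ∣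
  large-linear-forest-of-partition =
    let j , bound = weighted-pigeonhole 2 (λ i → ∣ colour-class col i ∣) (λ i → ∣ forest (F i) ∣) d
                                          (λ i → large (F i))
    in forest (F j) ,
       (acyclic (F j) ,
        λ u u∈ → ≤-trans (InducedMaxDegree≤-⊆ G (forest⊆Q (F j)) (Δ≤d j) u u∈) (d≤2 j)) ,
       subst (λ m → 2 * m ≤ ∑[ i < suc p ] suc (d i) * ∣ forest (F j) ∣) (∑∣colour-class∣≡n col) bound

factor-of-2 : ∀ a b → a * b ≡ 2 → 1 ≤ a × a ≤ 2 × 0 < b
factor-of-2 zero    b       ()
factor-of-2 (suc a) zero    ab≡2 = contradiction (trans (sym (*-zeroʳ (suc a))) ab≡2) λ ()
factor-of-2 (suc a) (suc b) ab≡2 =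
  s≤s z≤n , ≤-trans (m≤m*n (suc a) (suc b)) (≤-reflexive ab≡2) , s≤s z≤n

-- w j = 2 / d j is the weight of class j in the potential of LovászPartition.
record SplitInto2sAnd3s (m : ℕ) : Set where
  field
    parts    : ℕ
    d w      : Fin (suc parts) → ℕ
    d*w≡2    : ∀ j → d j * w j ≡ 2
    ∑[1+d]≡m : ∑[ j < suc parts ] suc (d j) ≡ m

prepend-2 : ∀ {m} → SplitInto2sAnd3s m → SplitInto2sAnd3s (2 + m)
prepend-2 S = record
  { parts    = suc parts
  ; d        = λ { zero → 1 ; (suc j) → d j }
  ; w        = λ { zero → 2 ; (suc j) → w j }
  ; d*w≡2    = λ { zero → refl ; (suc j) → d*w≡2 j }
  ; ∑[1+d]≡m = cong (2 +_) ∑[1+d]≡m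
  }
  where open SplitInto2sAnd3s S

split-into-2s-and-3s : ∀ r → 1 ≤ r → SplitInto2sAnd3s (r + 1)
split-into-2s-and-3s 1 _ =
  record { parts = 0 ; d = const 1 ; w = const 2 ; d*w≡2 = λ _ → refl ; ∑[1+d]≡m = refl }
split-into-2s-and-3s 2 _ =
  record { parts = 0 ; d = const 2 ; w = const 1 ; d*w≡2 = λ _ → refl ; ∑[1+d]≡m = refl }
split-into-2s-and-3s (suc (suc (suc r))) _ = prepend-2 (split-into-2s-and-3s (suc r) (s≤s z≤n))

large-linear-forest : ∀ {r} (G : Graph n) → Regular r G → SplitInto2sAnd3s (r + 1) →
                      Σ (Subset n) λ S → InducesLinearForest G S × 2 * n ≤ (r + 1) * ∣ S ∣
large-linear-forest {n} {r} G regular S = from-bounded (bounded-colouring (const zero))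
  where
  open SplitInto2sAnd3s S

  d-bounds : ∀ j → 1 ≤ d j × d j ≤ 2 × 0 < w j
  d-bounds j = factor-of-2 (d j) (w j) (d*w≡2 j)

  deg<∑[1+d] : ∀ x → deg G x < ∑[ j < suc parts ] suc (d j)
  deg<∑[1+d] x = subst₂ _<_ (sym (regular x)) (sym ∑[1+d]≡m) (m<m+n r (s≤s z≤n))

  open LovászPartition G d w 2 d*w≡2 (proj₂ ∘ proj₂ ∘ d-bounds) deg<∑[1+d]

  from-bounded : ∃ Bounded → Σ (Subset n) λ S → InducesLinearForest G S × 2 * n ≤ (r + 1) * ∣ S ∣
  from-bounded (col , bounded) rewrite sym ∑[1+d]≡m =
    large-linear-forest-of-partition G col d (proj₁ ∘ d-bounds) (proj₁ ∘ proj₂ ∘ d-bounds)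
      (bounded⇒class-max-degree col bounded)

-- Complete graphs

complete : ∀ n → Graph n
complete n = record
  { adj    = λ u v → not (does (u ≟ᶠ v))
  ; sym    = λ u v → cong not (≟-sym u v)
  ; irrefl = λ u → cong not (dec-true (u ≟ᶠ u) refl)
  }
  where
  ≟-sym : ∀ (u v : Fin n) → does (u ≟ᶠ v) ≡ does (v ≟ᶠ u)
  ≟-sym u v with u ≟ᶠ v | v ≟ᶠ u
  ... | yes _   | yes _   = refl
  ... | yes u≡v | no  v≢u = contradiction (sym u≡v) v≢u
  ... | no  u≢v | yes v≡u = contradiction (sym v≡u) u≢v
  ... | no  _   | no  _   = refl

∑-𝟙[≢] : ∀ {r} (u : Fin (suc r)) → ∑[ v < suc r ] 𝟙 (not (does (u ≟ᶠ v))) ≡ r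
∑-𝟙[≢] {r}     zero    = ∑-1≡n r
∑-𝟙[≢] {suc r} (suc u) = cong suc (∑-𝟙[≢] u)

complete-regular : ∀ r → Regular r (complete (suc r))
complete-regular r u = trans (∣tabulate∣≡∑𝟙 (λ v → not (does (u ≟ᶠ v)))) (∑-𝟙[≢] u)

complete-triangle : ∀ {T : Subset n} {x y z} → x ∈ T → y ∈ T → z ∈ T →
                    x ≢ y → x ≢ z → y ≢ z → CycleIn (complete n) T
complete-triangle {x = x} {y} {z} x∈T y∈T z∈T x≢y x≢z y≢z = record
  { m       = 0
  ; c       = c
  ; inj     = inj
  ; inS     = λ { zero → x∈T ; (suc zero) → y∈T ; (suc (suc zero)) → z∈T }
  ; step    = λ { zero → adjacent x≢y ; (suc zero) → adjacent y≢z }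
  ; closing = adjacent (x≢z ∘ sym)
  }
  where
  c : Fin 3 → Fin _
  c zero             = x
  c (suc zero)       = y
  c (suc (suc zero)) = z
  adjacent : ∀ {u v} → u ≢ v → not (does (u ≟ᶠ v)) ≡ true
  adjacent {u} {v} u≢v = cong not (dec-false (u ≟ᶠ v) u≢v)
  inj : Injective _≡_ _≡_ c
  inj {zero}           {zero}           _  = refl
  inj {zero}           {suc zero}       eq = contradiction eq x≢y
  inj {zero}           {suc (suc zero)} eq = contradiction eq x≢z
  inj {suc zero}       {zero}           eq = contradiction (sym eq) x≢y
  inj {suc zero}       {suc zero}       _  = refl
  inj {suc zero}       {suc (suc zero)} eq = contradiction eq y≢z
  inj {suc (suc zero)} {zero}           eq = contradiction (sym eq) x≢z
  inj {suc (suc zero)} {suc zero}       eq = contradiction (sym eq) y≢z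
  inj {suc (suc zero)} {suc (suc zero)} _  = refl

complete-linear-forest⇒∣T∣≤2 : ∀ {T : Subset n} → InducesLinearForest (complete n) T → ∣ T ∣ ≤ 2
complete-linear-forest⇒∣T∣≤2 {T = T} (acyclic , _) with ∣ T ∣ ≤? 2
... | yes ∣T∣≤2 = ∣T∣≤2
... | no  ∣T∣≰2 with 0<∣p∣⇒nonempty T (<-trans (s≤s z≤n) (≰⇒> ∣T∣≰2))
... | x , x∈T with 1<∣p∣⇒distinct (T - x) (s≤s⁻¹ (≤-trans (≰⇒> ∣T∣≰2) (∣p∣≤1+∣p-x∣ T x)))
... | y , z , y∈T-x , z∈T-x , y≢z = contradiction
  (complete-triangle x∈T (p─q⊆p T ⁅ x ⁆ y∈T-x) (p─q⊆p T ⁅ x ⁆ z∈T-x)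
     (x∈p-y⇒x≢y y∈T-x ∘ sym) (x∈p-y⇒x≢y z∈T-x ∘ sym) y≢z)
  acyclic

small⇒linear-forest : ∀ (G : Graph n) {T} → ∣ T ∣ ≤ 2 → InducesLinearForest G T
small⇒linear-forest G {T} ∣T∣≤2 =
  (λ C → <⇒≱ (s≤s ∣T∣≤2) (cycle⇒3≤∣S∣ C)) , λ u _ → ≤-trans (∣p∩q∣≤∣p∣ T (N G u)) ∣T∣≤2

complete-extremal : ∀ r → 1 ≤ r → Σ ℕ λ n → Σ (Graph n) λ G →
  0 < n × Regular r G ×
  Σ (Subset n) (λ S → InducesLinearForest G S × (r + 1) * ∣ S ∣ ≡ 2 * n) ×
  ((T : Subset n) → InducesLinearForest G T → (r + 1) * ∣ T ∣ ≤ 2 * n)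
complete-extremal (suc r) _ =
  suc (suc r) , complete (suc (suc r)) , s≤s z≤n , complete-regular (suc r) ,
  (pair , small⇒linear-forest _ (≤-reflexive ∣pair∣≡2) ,
   trans (cong ((suc r + 1) *_) ∣pair∣≡2) [r+1]*2≡2*n) ,
  λ T linear → ≤-trans (*-monoʳ-≤ (suc r + 1) (complete-linear-forest⇒∣T∣≤2 linear))
                       (≤-reflexive [r+1]*2≡2*n)
  where
  pair : Subset (suc (suc r))
  pair = inside ∷ inside ∷ ⊥
  ∣pair∣≡2 : ∣ pair ∣ ≡ 2
  ∣pair∣≡2 = cong (2 +_) (∣⊥∣≡0 r)
  [r+1]*2≡2*n : (suc r + 1) * 2 ≡ 2 * suc (suc r)
  [r+1]*2≡2*n = trans (*-comm (suc r + 1) 2) (cong (2 *_) (+-comm (suc r) 1))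

theorem1 : ((r : ℕ) → 1 ≤ r → (n : ℕ) → (G : Graph n) → Regular r G →
               Σ (Subset n) λ S → InducesLinearForest G S × 2 * n ≤ (r + 1) * ∣ S ∣)
             × ((r : ℕ) → 1 ≤ r → Σ ℕ λ n → Σ (Graph n) λ G →
               0 < n × Regular r G ×
               Σ (Subset n) (λ S → InducesLinearForest G S × (r + 1) * ∣ S ∣ ≡ 2 * n) ×
               ((T : Subset n) → InducesLinearForest G T → (r + 1) * ∣ T ∣ ≤ 2 * n))
theorem1 =
  (λ r 1≤r n G regular → large-linear-forest G regular (split-into-2s-and-3s r 1≤r)) ,
  complete-extremal
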